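{- Let $D=(V,E)$ be a finite digraph without loops and $H=(U,F)$ a digraph (loops allowed), and let $\varsigma\colon E\to U$ be an $H$-colouring of $D$. If every directed cycle of $D$ is an $H$-cycle, then every directed cycle of the $H$-closure $\mathcal{C}_H(D)$ has a symmetric arc.
   Context: An $H$-colouring of $D$ is a function $\varsigma\colon E\to U$. A walk $z_0z_1\dots z_k$ ($k\ge 1$) in $D$ is an $H$-walk if the sequence of colours $\varsigma(z_0z_1),\varsigma(z_1z_2),\dots,\varsigma(z_{k-1}z_k)$ is a walk in $H$, i.e. for each $1\le i\le k-1$, $\varsigma(z_{i-1}z_i)\varsigma(z_iz_{i+1})\in F$ (loops of $H$ allowed). A directed cycle of $D$ is an $H$-cycle if the sequence of colours of its arcs, read cyclically, is a closed walk in $H$, i.e. every two consecutive arcs of the cycle (including the last and the first) have colours forming an arc of $H$. The $H$-closure $\mathcal{C}_H(D)$ is the digraph with vertex set $V$ and an arc $uv$ ($u\ne v$) iff there is an $H$-walk in $D$ from $u$ to $v$. An arc $uv$ of a digraph is symmetric if $vu$ is also an arc. -}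

module Defs where

open import Level using (Level)
open import Data.Nat using (ℕ; zero; suc; _≤_)
open import Data.Fin using (Fin; zero; suc)
open import Data.Bool using (Bool; true)
open import Data.Maybe using (Maybe; just; nothing; fromMaybe)
import Data.Maybe as Maybe
open import Data.Product using (Σ; _×_; ∃)
open import Data.Unit using (⊤)
open import Data.Empty using (⊥)
open import Relation.Binary.PropositionalEquality using (_≡_; _≢_)
open import Function.Definitions using (Injective)

-- A finite digraph D on vertex set Fin n: arcs given by a Boolean adjacency
-- function (so there are no parallel arcs).
record Digraph (n : ℕ) : Set where
  field
    adj : Fin n → Fin n → Bool

  Arc : Fin n → Fin n → Set
  Arc u v = adj u v ≡ true

  Loopless : Set
  Loopless = ∀ v → adj v v ≡ true → ⊥

open Digraph public

-- cyclic successor on Fin (suc m): i ↦ i+1, last ↦ 0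
step : ∀ {m} → Fin (suc m) → Maybe (Fin (suc m))
step {zero}  zero    = nothing
step {suc m} zero    = just (suc zero)
step {suc m} (suc i) = Maybe.map suc (step i)

next : ∀ {m} → Fin (suc m) → Fin (suc m)
next i = fromMaybe zero (step i)

-- A directed cycle v₀ v₁ … v_m v₀ (m+1 ≥ 2 distinct vertices) in the
-- digraph whose arc relation is R.
record Cycle {n : ℕ} {ℓ : Level} (R : Fin n → Fin n → Set ℓ) : Set ℓ where
  field
    m       : ℕ
    m≥1     : 1 ≤ m
    vert    : Fin (suc m) → Fin n
    distinct : Injective _≡_ _≡_ vert
    arc     : ∀ i → R (vert i) (vert (next i))

open Cycle public

module _ {n : ℕ} (D : Digraph n) where

  data Walk : Fin n → Fin n → Set where
    [_] : ∀ {u v} → Arc D u v → Walk u v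
    _∷_ : ∀ {u w v} → Arc D u w → Walk w v → Walk u v

  module _ {U : Set} (F : U → U → Set) (ς : ∀ {u v} → Arc D u v → U) where

    firstColour : ∀ {u v} → Walk u v → U
    firstColour [ e ]   = ς e
    firstColour (e ∷ w) = ς e

    IsHWalk : ∀ {u v} → Walk u v → Set
    IsHWalk [ e ]   = ⊤
    IsHWalk (e ∷ w) = F (ς e) (firstColour w) × IsHWalk w

    IsHCycle : Cycle (Arc D) → Set
    IsHCycle C = ∀ i → F (ς (arc C i)) (ς (arc C (next i)))

    ClosureArc : Fin n → Fin n → Set
    ClosureArc u v = u ≢ v × Σ (Walk u v) IsHWalk

    HasSymmetricArc : Cycle ClosureArc → Set
    HasSymmetricArc C = ∃ λ i → ClosureArc (vert C (next i)) (vert C i)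

module Submission where

-- Let v₀ … v_m be a cycle of the closure, and for each arc v_i → v_{i+1}
-- choose an H-walk trimmed to a segment: it never returns to v_i and reaches
-- v_{i+1} only at its end.  Going round the cycle forever along these
-- segments gives an infinite trail in D, cut into blocks.  Inside a block the
-- trail turns H-compatibly.  At a block start r it also turns H-compatibly
-- as soon as the vertex at r occurs only once in some closed stretch around
-- r: erasing loops leaves a directed cycle through the two arcs at r, an
-- H-cycle by hypothesis.  A descent on closed stretches anchored at a block
-- start then finds a block i and an H-compatible stretch of the trail from
-- v_{i+1} back to v_i, which is the required symmetric arc.

open import Defs
open import Data.Fin using (Fin; zero; suc; fromℕ; toℕ)
import Data.Fin as Fin
open import Data.List using (List; []; _∷_; _++_; length)
import Data.List as List
open import Data.List.Relation.Unary.All using (All; []; _∷_)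
import Data.List.Relation.Unary.All as All
open import Data.List.Relation.Unary.All.Properties using (¬Any⇒All¬; ++⁺)
open import Data.List.Relation.Unary.Any using (here; there)
open import Data.List.Relation.Unary.Linked using (Linked; []; [-]; _∷_; _∷′_)
import Data.List.Relation.Unary.Linked as Linked
open import Data.List.Relation.Unary.Unique.Propositional using (Unique; []; _∷_)
open import Data.List.Membership.Propositional.Properties using (∈-lookup)
open import Data.Maybe using (just; nothing; fromMaybe)
import Data.Maybe as Maybe
open import Data.Maybe.Relation.Binary.Connected using (Connected)
import Data.Bool.Properties as Bool
open import Axiom.UniquenessOfIdentityProofs using (module Decidable⇒UIP)
open import Data.Nat using (ℕ; zero; suc; _+_; _∸_; _≤_; _<_; z≤n; s≤s; _≤?_; _<?_; _≤‴_; ≤‴-refl; ≤‴-step)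
open import Data.Nat.Properties hiding (_≟_)
open import Data.Fin.Properties using (_≟_; pigeonhole)
open import Data.Nat.Induction using (<-wellFounded)
open import Data.Product using (Σ; _×_; _,_; proj₁; proj₂; ∃; ∃₂)
import Data.Product as Σ
open import Data.Sum using (_⊎_; inj₁; inj₂)
import Data.Sum as Sum
open import Data.Unit using (⊤; tt)
open import Function using (const)
open import Induction.WellFounded using (Acc; acc)
open import Relation.Nullary using (¬_; yes; no; contradiction)
open import Relation.Nullary.Decidable using (_×-dec_)
open import Relation.Binary using (DecidableEquality; tri<; tri≈; tri>)
open import Relation.Binary.PropositionalEquality using (_≡_; _≢_; refl; sym; trans; cong; subst; subst₂)
open Relation.Binary.PropositionalEquality.≡-Reasoning

bounded-choice : ∀ {A : Set} {B : ℕ → Set} v →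
                 (∀ n → n < v → A ⊎ B n) → A ⊎ (∀ n → n < v → B n)
bounded-choice zero    h = inj₂ λ _ ()
bounded-choice (suc v) h
  with h v ≤-refl | bounded-choice v (λ n n<v → h n (m<n⇒m<1+n n<v))
... | inj₁ a  | _       = inj₁ a
... | inj₂ _  | inj₁ a  = inj₁ a
... | inj₂ bv | inj₂ bs = inj₂ everywhere
  where
  everywhere : ∀ n → n < suc v → _
  everywhere n (s≤s n≤v) with m≤n⇒m<n∨m≡n n≤v
  ... | inj₁ n<v  = bs n n<v
  ... | inj₂ refl = bv

narrower : ∀ {lo hi a b} → lo ≤ a → a ≤ b → b ≤ hi → lo < a ⊎ b < hi →
           b ∸ a < hi ∸ lo
narrower {lo} {hi} {a} {b} lo≤a a≤b b≤hi (inj₁ lo<a) =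
  <-≤-trans (∸-monoʳ-< lo<a a≤b) (∸-monoˡ-≤ lo b≤hi)
narrower {lo} {hi} {a} {b} lo≤a a≤b b≤hi (inj₂ b<hi) =
  ≤-<-trans (∸-monoʳ-≤ b lo≤a) (∸-monoˡ-< b<hi (≤-trans lo≤a a≤b))

-- The combinatorial core of the proof, for any sequence f of vertices cut
-- into consecutive blocks start k … start (k+1) such that the start vertex
-- of a block never reappears inside it and its end vertex never appears
-- earlier in it.
module Descent {V : Set} (_≟_ : DecidableEquality V) (f : ℕ → V)
  (Turns : ℕ → Set) (start : ℕ → ℕ)
  (start-zero   : start 0 ≡ 0)
  (start-step   : ∀ k → start k < start (suc k))
  (startOrTurns : ∀ r → (∃ λ k → start k ≡ r) ⊎ Turns r)
  (leaves       : ∀ k r → start k < r → r ≤ start (suc k) → f r ≢ f (start k))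
  (arrives      : ∀ k r → start k ≤ r → r < start (suc k) → f r ≢ f (start (suc k)))
  (onceVisited  : ∀ s r u → s < r → r < u → f s ≡ f u →
                  (∀ t → s ≤ t → t ≤ u → f t ≡ f r → t ≡ r) → Turns r)
  where

  record Stretch : Set where
    field
      k s s'   : ℕ
      s<s'     : s < s'
      from-end : f s ≡ f (start (suc k))
      to-start : f s' ≡ f (start k)

  record Shortcut : Set where
    field
      stretch : Stretch
    open Stretch stretch public
    field
      good : ∀ r → s < r → r < s' → Turns r

  record Candidate (lo hi : ℕ) : Set where
    field
      lo<hi    : lo < hi
      closed   : f lo ≡ f hi
      anchored : (∃ λ k → start k ≡ lo) ⊎ (∃ λ k → start k ≡ hi)

  record Narrower (lo hi : ℕ) : Set where
    field
      lo′ hi′   : ℕ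
      candidate : Candidate lo′ hi′
      shrinks   : hi′ ∸ lo′ < hi ∸ lo

  record Window (lo hi : ℕ) : Set where
    field
      stretch : Stretch
    open Stretch stretch public
    field
      lo≤s  : lo ≤ s
      s'≤hi : s' ≤ hi

  -- Every candidate contains a window: if lo = start k, block k ends
  -- strictly before hi (its start vertex does not reappear inside it); if
  -- hi = start (k+1), block k starts strictly after lo (its end vertex does
  -- not appear earlier in it).
  window : ∀ {lo hi} → Candidate lo hi → Window lo hi
  window {lo} {hi} record { lo<hi = lo<hi ; closed = closed ; anchored = inj₁ (k , refl) }
    with hi ≤? start (suc k)
  ... | yes hi≤ = contradiction (sym closed) (leaves k hi lo<hi hi≤)
  ... | no  hi≰ = record
        { stretch = record { k = k ; s = start (suc k) ; s' = hi ; s<s' = ≰⇒> hi≰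
                           ; from-end = refl ; to-start = sym closed }
        ; lo≤s = <⇒≤ (start-step k) ; s'≤hi = ≤-refl }
  window {lo} record { lo<hi = lo<hi ; anchored = inj₂ (zero , refl) } =
    contradiction (subst (lo <_) start-zero lo<hi) n≮0
  window {lo} record { lo<hi = lo<hi ; closed = closed ; anchored = inj₂ (suc k , refl) }
    with start k ≤? lo
  ... | yes start≤lo = contradiction closed (arrives k lo start≤lo lo<hi)
  ... | no  start≰lo = record
        { stretch = record { k = k ; s = lo ; s' = start k ; s<s' = ≰⇒> start≰lo
                           ; from-end = closed ; to-start = refl }
        ; lo≤s = ≤-refl ; s'≤hi = <⇒≤ (start-step k) }

  -- An interior position r of a candidate either turns well or yields a
  -- narrower candidate: a block start whose vertex occurs a second time in
  -- lo … hi closes a shorter anchored stretch with that occurrence, and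
  -- otherwise its vertex occurs only once in the closed stretch lo … hi.
  interior : ∀ {lo hi} → Candidate lo hi → ∀ r → lo < r → r < hi →
             Narrower lo hi ⊎ Turns r
  interior {lo} {hi} c r lo<r r<hi with startOrTurns r
  ... | inj₂ turns = inj₂ turns
  ... | inj₁ isStart
    with anyUpTo? (λ t → lo ≤? t ×-dec f t ≟ f r) r
       | anyUpTo? (λ t → r <? t ×-dec f t ≟ f r) (suc hi)
  ... | yes (t , t<r , lo≤t , same) | _ = inj₁ record
        { lo′ = t ; hi′ = r
        ; candidate = record { lo<hi = t<r ; closed = same ; anchored = inj₂ isStart }
        ; shrinks = narrower lo≤t (<⇒≤ t<r) (<⇒≤ r<hi) (inj₂ r<hi) }
  ... | no _ | yes (t , t≤hi , r<t , same) = inj₁ record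
        { lo′ = r ; hi′ = t
        ; candidate = record { lo<hi = r<t ; closed = sym same ; anchored = inj₁ isStart }
        ; shrinks = narrower (<⇒≤ lo<r) (<⇒≤ r<t) (≤-pred t≤hi) (inj₁ lo<r) }
  ... | no below | no above = inj₂ (onceVisited lo r hi lo<r r<hi (Candidate.closed c) unique)
    where
    unique : ∀ t → lo ≤ t → t ≤ hi → f t ≡ f r → t ≡ r
    unique t lo≤t t≤hi same with <-cmp t r
    ... | tri< t<r _ _ = contradiction (t , t<r , lo≤t , same) below
    ... | tri≈ _ t≡r _ = t≡r
    ... | tri> _ _ r<t = contradiction (t , s≤s t≤hi , r<t , same) above

  descend : ∀ lo hi → Acc _<_ (hi ∸ lo) → Candidate lo hi → Shortcut
  descend lo hi (acc rec) c = conclude (bounded-choice s' inside)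
    where
    open Window (window c)

    inside : ∀ r → r < s' → Narrower lo hi ⊎ (s < r → Turns r)
    inside r r<s' with s <? r
    ... | no  s≮r = inj₂ λ s<r → contradiction s<r s≮r
    ... | yes s<r = Sum.map₂ const
                      (interior c r (≤-<-trans lo≤s s<r) (<-≤-trans r<s' s'≤hi))

    conclude : Narrower lo hi ⊎ (∀ r → r < s' → s < r → Turns r) → Shortcut
    conclude (inj₁ narrower′) = descend lo′ hi′ (rec shrinks) candidate
      where open Narrower narrower′
    conclude (inj₂ good) = record
      { stretch = stretch ; good = λ r s<r r<s' → good r r<s' s<r }

  shortcut : ∀ {lo hi} → Candidate lo hi → Shortcut
  shortcut {lo} {hi} = descend lo hi (<-wellFounded (hi ∸ lo))

lastOf : ∀ {A : Set} → A → List A → A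
lastOf x []       = x
lastOf _ (y ∷ ys) = lastOf y ys

glue : ∀ {A : Set} {R : A → A → Set} {x y} xs ys → Linked R (x ∷ xs) →
       Linked R (y ∷ ys) → lastOf x xs ≡ y → Linked R (x ∷ xs ++ ys)
glue []        ys _       l′ refl = l′
glue (_ ∷ xs) ys (r ∷ l) l′ e    = r ∷ glue xs ys l l′ e

lastOf-++ : ∀ {A : Set} {x y : A} xs ys → lastOf x xs ≡ y → lastOf x (xs ++ ys) ≡ lastOf y ys
lastOf-++ []       ys refl = refl
lastOf-++ (_ ∷ xs) ys e    = lastOf-++ xs ys e

module LoopErasure {V : Set} (_≟_ : DecidableEquality V) where
  open import Data.List.Membership.DecPropositional _≟_ using (_∈_; _∈?_)

  suffixFrom : V → List V → List V
  suffixFrom x [] = []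
  suffixFrom x (y ∷ ys) with x ≟ y
  ... | yes _ = y ∷ ys
  ... | no  _ = suffixFrom x ys

  erase : List V → List V
  erase [] = []
  erase (x ∷ xs) with x ∈? erase xs
  ... | yes _ = suffixFrom x (erase xs)
  ... | no  _ = x ∷ erase xs

  suffixFrom-cons : ∀ {x} ys → x ∈ ys → ∃ λ rs → suffixFrom x ys ≡ x ∷ rs
  suffixFrom-cons {x} (y ∷ ys) x∈ with x ≟ y | x∈
  ... | yes refl | _         = ys , refl
  ... | no x≢y   | here x≡y  = contradiction x≡y x≢y
  ... | no _     | there x∈′ = suffixFrom-cons ys x∈′

  suffixFrom-last : ∀ {x} ys → x ∈ ys → ∀ d d′ → lastOf d (suffixFrom x ys) ≡ lastOf d′ ys
  suffixFrom-last {x} (y ∷ ys) x∈ d d′ with x ≟ y | x∈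
  ... | yes _  | _         = refl
  ... | no x≢y | here x≡y  = contradiction x≡y x≢y
  ... | no _   | there x∈′ = suffixFrom-last ys x∈′ d y

  suffixFrom-all : ∀ {P : V → Set} {x} ys → All P ys → All P (suffixFrom x ys)
  suffixFrom-all {x = x} [] ps = ps
  suffixFrom-all {x = x} (y ∷ ys) (py ∷ ps) with x ≟ y
  ... | yes _ = py ∷ ps
  ... | no  _ = suffixFrom-all ys ps

  suffixFrom-unique : ∀ {x} ys → Unique ys → Unique (suffixFrom x ys)
  suffixFrom-unique {x} [] u = u
  suffixFrom-unique {x} (y ∷ ys) (y∉ ∷ u) with x ≟ y
  ... | yes _ = y∉ ∷ u
  ... | no  _ = suffixFrom-unique ys u

  suffixFrom-linked : ∀ {R : V → V → Set} {x} ys → Linked R ys → Linked R (suffixFrom x ys)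
  suffixFrom-linked {x = x} [] l = l
  suffixFrom-linked {x = x} (y ∷ ys) l with x ≟ y
  ... | yes _ = l
  ... | no  _ = suffixFrom-linked ys (Linked.tail l)

  erase-cons : ∀ x xs → ∃ λ rs → erase (x ∷ xs) ≡ x ∷ rs
  erase-cons x xs with x ∈? erase xs
  ... | yes x∈ = suffixFrom-cons (erase xs) x∈
  ... | no  _  = erase xs , refl

  erase-head : ∀ xs → List.head (erase xs) ≡ List.head xs
  erase-head []       = refl
  erase-head (x ∷ xs) = cong List.head (proj₂ (erase-cons x xs))

  erase-last : ∀ d xs → lastOf d (erase xs) ≡ lastOf d xs
  erase-last d [] = refl
  erase-last d (x ∷ xs) with x ∈? erase xs
  ... | yes x∈ = trans (suffixFrom-last (erase xs) x∈ d x) (erase-last x xs)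
  ... | no  _  = erase-last x xs

  erase-all : ∀ {P : V → Set} xs → All P xs → All P (erase xs)
  erase-all [] ps = ps
  erase-all (x ∷ xs) (px ∷ ps) with x ∈? erase xs
  ... | yes _ = suffixFrom-all (erase xs) (erase-all xs ps)
  ... | no  _ = px ∷ erase-all xs ps

  erase-unique : ∀ xs → Unique (erase xs)
  erase-unique [] = []
  erase-unique (x ∷ xs) with x ∈? erase xs
  ... | yes _  = suffixFrom-unique (erase xs) (erase-unique xs)
  ... | no  x∉ = ¬Any⇒All¬ (erase xs) x∉ ∷ erase-unique xs

  erase-linked : ∀ {R : V → V → Set} xs → Linked R xs → Linked R (erase xs)
  erase-linked [] l = l
  erase-linked {R} (x ∷ xs) l with x ∈? erase xs
  ... | yes _ = suffixFrom-linked (erase xs) (erase-linked xs (Linked.tail l))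
  ... | no  _ = subst (Connected R (just x)) (sym (erase-head xs)) (Linked.head′ l)
                  ∷′ erase-linked xs (Linked.tail l)

module ListCycle {n : ℕ} (R : Fin n → Fin n → Set) where

  lookup-injective : ∀ (xs : List (Fin n)) → Unique xs →
                     ∀ i j → List.lookup xs i ≡ List.lookup xs j → i ≡ j
  lookup-injective (x ∷ xs) (x∉ ∷ u) zero    zero    _ = refl
  lookup-injective (x ∷ xs) (x∉ ∷ u) zero    (suc j) e = contradiction e (All.lookup x∉ (∈-lookup j))
  lookup-injective (x ∷ xs) (x∉ ∷ u) (suc i) zero    e = contradiction (sym e) (All.lookup x∉ (∈-lookup i))
  lookup-injective (x ∷ xs) (x∉ ∷ u) (suc i) (suc j) e = cong suc (lookup-injective xs u i j e)

  -- the arc out of the i-th vertex of y ∷ ys, where the last vertex is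
  -- followed by p
  closingArcs : ∀ {p} (y : Fin n) ys → Linked R (y ∷ ys) → R (lastOf y ys) p →
                (i : Fin (suc (length ys))) →
                R (List.lookup (y ∷ ys) i) (fromMaybe p (Maybe.map (List.lookup (y ∷ ys)) (step i)))
  closingArcs y []       _        yp zero    = yp
  closingArcs y (z ∷ zs) (yz ∷ _) _  zero    = yz
  closingArcs y (z ∷ zs) (_ ∷ l)  zp (suc i) with step i | closingArcs z zs l zp i
  ... | just _  | arc′ = arc′
  ... | nothing | arc′ = arc′

  lookup-next : ∀ (x : Fin n) xs (i : Fin (suc (length xs))) →
                List.lookup (x ∷ xs) (next i) ≡ fromMaybe x (Maybe.map (List.lookup (x ∷ xs)) (step i))
  lookup-next x xs i with step i
  ... | just _  = refl
  ... | nothing = refl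

  lookup-fromℕ : ∀ (x : Fin n) xs → List.lookup (x ∷ xs) (fromℕ (length xs)) ≡ lastOf x xs
  lookup-fromℕ x []       = refl
  lookup-fromℕ x (y ∷ ys) = lookup-fromℕ y ys

  listCycle : ∀ p ps → 1 ≤ length ps → Unique (p ∷ ps) → Linked R (p ∷ ps) →
              R (lastOf p ps) p → Cycle R
  listCycle p ps m≥1 u l close = record
    { m        = length ps
    ; m≥1      = m≥1
    ; vert     = List.lookup (p ∷ ps)
    ; distinct = λ {i} {j} → lookup-injective (p ∷ ps) u i j
    ; arc      = λ i → subst (R (List.lookup (p ∷ ps) i)) (sym (lookup-next p ps i))
                             (closingArcs p ps l close i) }

next-last : ∀ m → next (fromℕ m) ≡ zero
next-last m = cong (fromMaybe zero) (step-last m)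
  where
  step-last : ∀ m → step (fromℕ m) ≡ nothing
  step-last zero    = refl
  step-last (suc m) = cong (Maybe.map suc) (step-last m)

module _ {n : ℕ} (D : Digraph n) {U : Set} (F : U → U → Set)
         (ς : ∀ {u v} → Arc D u v → U) where

  -- The colour of an arc depends only on its endpoints, since arcs are
  -- proofs of adj u v ≡ true and equality on Bool is proof-irrelevant.
  colour-endpoints : ∀ {x y x′ y′} (a : Arc D x y) (a′ : Arc D x′ y′) →
                     x ≡ x′ → y ≡ y′ → ς a ≡ ς a′
  colour-endpoints a a′ refl refl = cong ς (Decidable⇒UIP.≡-irrelevant Bool._≟_ a a′)

  -- Positional view of a walk: its length, its o-th vertex (the endpoint
  -- for o beyond the length) and its o-th arc.
  len : ∀ {u v} → Walk D u v → ℕ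
  len [ _ ]   = 1
  len (_ ∷ w) = suc (len w)

  vertexAt : ∀ {u v} → Walk D u v → ℕ → Fin n
  vertexAt {u} w           zero    = u
  vertexAt {v = v} [ _ ]   (suc o) = v
  vertexAt (_ ∷ w)         (suc o) = vertexAt w o

  arcAt : ∀ {u v} (w : Walk D u v) o → o < len w →
          Arc D (vertexAt w o) (vertexAt w (suc o))
  arcAt [ e ]   zero    _        = e
  arcAt [ e ]   (suc o) (s≤s ())
  arcAt (e ∷ w) zero    _        = e
  arcAt (e ∷ w) (suc o) (s≤s lt) = arcAt w o lt

  len-pos : ∀ {u v} (w : Walk D u v) → 0 < len w
  len-pos [ _ ]   = s≤s z≤n
  len-pos (_ ∷ _) = s≤s z≤n

  walk-end : ∀ {u v} (w : Walk D u v) → ∃ λ o → suc o ≡ len w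
  walk-end [ _ ]   = 0 , refl
  walk-end (_ ∷ w) = len w , refl

  vertexAt-end : ∀ {u v} (w : Walk D u v) → vertexAt w (len w) ≡ v
  vertexAt-end [ _ ]   = refl
  vertexAt-end (_ ∷ w) = vertexAt-end w

  firstColour-arcAt : ∀ {u v} (w : Walk D u v) (lt : 0 < len w) →
                      ς (arcAt w 0 lt) ≡ firstColour D F ς w
  firstColour-arcAt [ _ ]   _ = refl
  firstColour-arcAt (_ ∷ _) _ = refl

  hwalk-turns : ∀ {u v} (w : Walk D u v) → IsHWalk D F ς w →
                ∀ o (lt : o < len w) (lt′ : suc o < len w) →
                F (ς (arcAt w o lt)) (ς (arcAt w (suc o) lt′))
  hwalk-turns [ _ ]   _        o       _ (s≤s ())
  hwalk-turns (e ∷ w) (fe , _) zero    _ (s≤s lt′) =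
    subst (F (ς e)) (sym (firstColour-arcAt w lt′)) fe
  hwalk-turns (e ∷ w) (_ , h)  (suc o) (s≤s lt) (s≤s lt′) = hwalk-turns w h o lt lt′

  Leaves : ∀ {u v} → Walk D u v → Set
  Leaves {u} w = ∀ o → 0 < o → o ≤ len w → vertexAt w o ≢ u

  Arrives : ∀ {u v} → Walk D u v → Set
  Arrives {v = v} w = ∀ o → o < len w → vertexAt w o ≢ v

  record Segment (u v : Fin n) : Set where
    field
      walk    : Walk D u v
      hwalk   : IsHWalk D F ς walk
      leaves  : Leaves walk
      arrives : Arrives walk

  arrives-single : ∀ {u v} {e : Arc D u v} → u ≢ v → Arrives [ e ]
  arrives-single u≢v zero    _        = u≢v
  arrives-single u≢v (suc o) (s≤s ())

  arrives-cons : ∀ {u z v} {e : Arc D u z} {w : Walk D z v} →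
                 u ≢ v → Arrives w → Arrives (e ∷ w)
  arrives-cons u≢v a zero    _        = u≢v
  arrives-cons u≢v a (suc o) (s≤s lt) = a o lt

  -- Stopping an H-walk at its first visit of the endpoint gives an H-walk
  -- (with the same first colour, so that it can be extended backwards).
  firstArrival : ∀ {u v} (w : Walk D u v) → IsHWalk D F ς w → u ≢ v →
                 Σ (Walk D u v) λ w′ → IsHWalk D F ς w′ × Arrives w′ ×
                                       firstColour D F ς w′ ≡ firstColour D F ς w
  firstArrival [ e ] _ u≢v = [ e ] , tt , arrives-single u≢v , refl
  firstArrival {v = v} (_∷_ {w = z} e w) (fe , h) u≢v with z ≟ v
  ... | yes refl = [ e ] , tt , arrives-single u≢v , refl
  ... | no z≢v with firstArrival w h z≢v
  ...   | w′ , h′ , a′ , same =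
          e ∷ w′ , (subst (F (ς e)) (sym same) fe , h′) , arrives-cons u≢v a′ , refl

  lastDeparture : ∀ {z v} u → u ≢ v → (w : Walk D z v) → IsHWalk D F ς w → Arrives w →
                  Segment u v ⊎ (∀ o → o ≤ len w → vertexAt w o ≢ u)
  lastDeparture {z} u u≢v [ e ] _ a with z ≟ u
  ... | yes refl = inj₁ record
        { walk = [ e ] ; hwalk = tt ; arrives = a
        ; leaves = λ { (suc zero) _ _ v≡u → u≢v (sym v≡u) ; (suc (suc o)) _ (s≤s ()) } }
  ... | no z≢u = inj₂ λ { zero _ → z≢u
                        ; (suc zero) _ v≡u → u≢v (sym v≡u)
                        ; (suc (suc o)) (s≤s ()) }
  lastDeparture {z} u u≢v (e ∷ w) (fe , h) a
    with lastDeparture u u≢v w h (λ o lt → a (suc o) (s≤s lt))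
  ... | inj₁ seg = inj₁ seg
  ... | inj₂ absent with z ≟ u
  ...   | yes refl = inj₁ record
          { walk = e ∷ w ; hwalk = fe , h ; arrives = a
          ; leaves = λ { (suc o) _ (s≤s o≤) → absent o o≤ } }
  ...   | no z≢u = inj₂ λ { zero _ → z≢u ; (suc o) (s≤s o≤) → absent o o≤ }

  trim : ∀ {u v} → u ≢ v → (w : Walk D u v) → IsHWalk D F ς w → Segment u v
  trim {u} u≢v w h with firstArrival w h u≢v
  ... | w′ , h′ , a′ , _ with lastDeparture u u≢v w′ h′ a′
  ...   | inj₁ seg    = seg
  ...   | inj₂ absent = contradiction refl (absent 0 z≤n)

  open LoopErasure (_≟_ {n})
  open ListCycle (Arc D)

  -- Turns r says that the two edges meeting at
  -- position r have colours forming an arc of H; position 0 has no incoming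
  -- edge and is never an interior position of a stretch.
  module Trail (f : ℕ → Fin n) (edge : ∀ q → Arc D (f q) (f (suc q))) where

    Turns : ℕ → Set
    Turns zero    = ⊤
    Turns (suc q) = F (ς (edge q)) (ς (edge (suc q)))

    stretchWalk : ∀ {s e} → suc s ≤‴ e → (∀ r → s < r → r < e → Turns r) →
                  Σ (Walk D (f s) (f e)) λ w → IsHWalk D F ς w × firstColour D F ς w ≡ ς (edge s)
    stretchWalk ≤‴-refl _ = [ edge _ ] , tt , refl
    stretchWalk {s} (≤‴-step s<e) turns
      with stretchWalk s<e (λ r s′<r → turns r (<-trans (n<1+n s) s′<r))
    ... | w , h , first =
          edge s ∷ w , (subst (F (ς (edge s))) (sym first) (turns (suc s) ≤-refl (≤‴⇒≤ s<e)) , h) , refl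

    -- the vertices at the positions after a, up to and including c
    after : ∀ {a c} → a ≤‴ c → List (Fin n)
    after ≤‴-refl         = []
    after {a} (≤‴-step p) = f (suc a) ∷ after p

    after-linked : ∀ {a c} (p : a ≤‴ c) → Linked (Arc D) (f a ∷ after p)
    after-linked ≤‴-refl         = [-]
    after-linked {a} (≤‴-step p) = edge a ∷ after-linked p

    after-last : ∀ {a c} (p : a ≤‴ c) → lastOf (f a) (after p) ≡ f c
    after-last ≤‴-refl     = refl
    after-last (≤‴-step p) = after-last p

    after-all : ∀ {P : Fin n → Set} {a c} (p : a ≤‴ c) →
                (∀ t → a < t → t ≤ c → P (f t)) → All P (after p)
    after-all ≤‴-refl         _ = []
    after-all {a = a} (≤‴-step p) h =
      h (suc a) ≤-refl (≤‴⇒≤ p) ∷ after-all p (λ t a′<t → h t (<-trans (n<1+n a) a′<t))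

  module _ (allHCycles : (C : Cycle (Arc D)) → IsHCycle D F ς C) where

    -- The key consequence of the hypothesis: a closed walk p → z → ⋯ → x → p
    -- passing through p only once turns H-compatibly at p.  Erasing the loops
    -- of its part from z to x leaves a directed cycle through the arcs x → p
    -- and p → z, and that cycle is an H-cycle.
    onceVisitedTurn : ∀ {x p z} (a : Arc D x p) (b : Arc D p z) zs →
                      Linked (Arc D) (z ∷ zs) → lastOf z zs ≡ x → All (_≢ p) (z ∷ zs) →
                      F (ς a) (ς b)
    onceVisitedTurn {x} {p} {z} a b zs linked ends avoids with erase-cons z zs
    ... | rs , erased =
      subst₂ F (colour-endpoints (arc C final) a at-final at-p)
               (colour-endpoints (arc C (next final)) b at-p at-z)
               (allHCycles C final)
      where
      path : List (Fin n)
      path = z ∷ rs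

      path-ends : lastOf p path ≡ x
      path-ends = trans (cong (lastOf p) (sym erased)) (trans (erase-last p (z ∷ zs)) ends)

      C : Cycle (Arc D)
      C = listCycle p path (s≤s z≤n)
            (All.map (λ v≢p p≡v → v≢p (sym p≡v)) (subst (All (_≢ p)) erased (erase-all (z ∷ zs) avoids))
              ∷ subst Unique erased (erase-unique (z ∷ zs)))
            (b ∷ subst (Linked (Arc D)) erased (erase-linked (z ∷ zs) linked))
            (subst (λ v → Arc D v p) (sym path-ends) a)

      final : Fin (suc (length path))
      final = fromℕ (length path)

      at-final : vert C final ≡ x
      at-final = trans (lookup-fromℕ p path) path-ends

      at-p : vert C (next final) ≡ p
      at-p = cong (List.lookup (p ∷ path)) (next-last (length path))

      at-z : vert C (next (next final)) ≡ z
      at-z = cong (λ i → List.lookup (p ∷ path) (next i)) (next-last (length path))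

    -- On a trail: if f s ≡ f u and the vertex at an interior position r
    -- occurs only once in s … u, then the trail turns well at r (apply the
    -- previous lemma to the closed walk f r → ⋯ → f u = f s → ⋯ → f r).
    module _ {f : ℕ → Fin n} {edge : ∀ q → Arc D (f q) (f (suc q))} where
      open Trail f edge

      onceVisited : ∀ s r u → s < r → r < u → f s ≡ f u →
                    (∀ t → s ≤ t → t ≤ u → f t ≡ f r → t ≡ r) → Turns r
      onceVisited s (suc q) u (s≤s s≤q) r<u closed unique =
        onceVisitedTurn (edge q) (edge (suc q)) (after onward ++ after back) linked ends avoids
        where
        onward : suc (suc q) ≤‴ u
        onward = ≤⇒≤‴ r<u

        back : s ≤‴ q
        back = ≤⇒≤‴ s≤q

        meet : lastOf (f (suc (suc q))) (after onward) ≡ f s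
        meet = trans (after-last onward) (sym closed)

        linked : Linked (Arc D) (f (suc (suc q)) ∷ after onward ++ after back)
        linked = glue (after onward) (after back) (after-linked onward) (after-linked back) meet

        ends : lastOf (f (suc (suc q))) (after onward ++ after back) ≡ f q
        ends = trans (lastOf-++ (after onward) (after back) meet) (after-last back)

        differs : ∀ t → t ≢ suc q → s ≤ t → t ≤ u → f t ≢ f (suc q)
        differs t t≢r s≤t t≤u same = t≢r (unique t s≤t t≤u same)

        avoids : All (_≢ f (suc q)) (f (suc (suc q)) ∷ after onward ++ after back)
        avoids = differs (suc (suc q)) (>⇒≢ ≤-refl) (m≤n⇒m≤1+n (m≤n⇒m≤1+n s≤q)) r<u
               ∷ ++⁺ (after-all onward λ t r<t t≤u →
                        differs t (>⇒≢ (<-trans ≤-refl r<t)) (<⇒≤ (<-trans (s≤s s≤q) (<-trans ≤-refl r<t))) t≤u)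
                     (after-all back λ t s<t t≤q →
                        differs t (<⇒≢ (s≤s t≤q)) (<⇒≤ s<t) (≤-trans t≤q (<⇒≤ (<-trans ≤-refl r<u))))

  last-offset : ∀ {o m} → o < m → ¬ suc o < m → suc o ≡ m
  last-offset lt ¬lt = ≤-antisym lt (≮⇒≥ ¬lt)

  -- Flattening an infinite sequence of segments S k : x k → x (k+1) into a
  -- trail.  Block k occupies the positions start k … start (k+1), and a
  -- position is located as a pair (block, offset).
  module Flatten (x : ℕ → Fin n) (S : ∀ k → Segment (x k) (x (suc k))) where

    W : ∀ k → Walk D (x k) (x (suc k))
    W k = Segment.walk (S k)

    size : ℕ → ℕ
    size k = len (W k)

    start : ℕ → ℕ
    start zero    = 0
    start (suc k) = start k + size k

    advance : ℕ × ℕ → ℕ × ℕ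
    advance (k , o) with suc o <? size k
    ... | yes _ = k , suc o
    ... | no  _ = suc k , 0

    locate : ℕ → ℕ × ℕ
    locate zero    = 0 , 0
    locate (suc q) = advance (locate q)

    point : ℕ × ℕ → Fin n
    point (k , o) = vertexAt (W k) o

    vertex : ℕ → Fin n
    vertex q = point (locate q)

    advance-inside : ∀ {k o} → suc o < size k → advance (k , o) ≡ (k , suc o)
    advance-inside {k} {o} lt with suc o <? size k
    ... | yes _  = refl
    ... | no ¬lt = contradiction lt ¬lt

    advance-wrap : ∀ {k o} → ¬ suc o < size k → advance (k , o) ≡ (suc k , 0)
    advance-wrap {k} {o} ¬lt with suc o <? size k
    ... | yes lt = contradiction lt ¬lt
    ... | no  _  = refl

    locate-valid : ∀ q → proj₂ (locate q) < size (proj₁ (locate q))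
    locate-valid zero = len-pos (W 0)
    locate-valid (suc q) with locate q | locate-valid q
    ... | k , o | _ with suc o <? size k
    ...   | yes lt = lt
    ...   | no  _  = len-pos (W (suc k))

    point-advance : ∀ k o → o < size k → point (advance (k , o)) ≡ vertexAt (W k) (suc o)
    point-advance k o lt with suc o <? size k
    ... | yes _  = refl
    ... | no ¬lt = trans (sym (vertexAt-end (W k))) (cong (vertexAt (W k)) (sym (last-offset lt ¬lt)))

    edge : ∀ q → Arc D (vertex q) (vertex (suc q))
    edge q with locate q | locate-valid q
    ... | k , o | valid =
          subst (Arc D (vertexAt (W k) o)) (sym (point-advance k o valid)) (arcAt (W k) o valid)

    open Trail vertex edge public

    locate-start  : ∀ k → locate (start k) ≡ (k , 0)
    locate-within : ∀ k o → o < size k → locate (start k + o) ≡ (k , o)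

    locate-start zero    = refl
    locate-start (suc k) with walk-end (W k)
    ... | o , o+1≡size = begin
      locate (start k + size k)       ≡⟨ cong (λ m → locate (start k + m)) (sym o+1≡size) ⟩
      locate (start k + suc o)        ≡⟨ cong locate (+-suc (start k) o) ⟩
      advance (locate (start k + o))  ≡⟨ cong advance (locate-within k o (subst (o <_) o+1≡size ≤-refl)) ⟩
      advance (k , o)                 ≡⟨ advance-wrap (<-irrefl o+1≡size) ⟩
      (suc k , 0)                     ∎

    locate-within k zero    _  = trans (cong locate (+-identityʳ (start k))) (locate-start k)
    locate-within k (suc o) lt = begin
      locate (start k + suc o)        ≡⟨ cong locate (+-suc (start k) o) ⟩
      advance (locate (start k + o))  ≡⟨ cong advance (locate-within k o (<-trans (n<1+n o) lt)) ⟩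
      advance (k , o)                 ≡⟨ advance-inside lt ⟩
      (k , suc o)                     ∎

    locate-position : ∀ q → start (proj₁ (locate q)) + proj₂ (locate q) ≡ q
    locate-position zero = refl
    locate-position (suc q) with locate q | locate-position q | locate-valid q
    ... | k , o | at-q | valid with suc o <? size k
    ...   | yes _  = trans (+-suc (start k) o) (cong suc at-q)
    ...   | no ¬lt = begin
      start k + size k + 0  ≡⟨ +-identityʳ _ ⟩
      start k + size k      ≡⟨ cong (start k +_) (sym (last-offset valid ¬lt)) ⟩
      start k + suc o       ≡⟨ +-suc (start k) o ⟩
      suc (start k + o)     ≡⟨ cong suc at-q ⟩
      suc q                 ∎

    vertex-start : ∀ k → vertex (start k) ≡ x k
    vertex-start k = cong point (locate-start k)

    vertex-block : ∀ k o → o ≤ size k → vertex (start k + o) ≡ vertexAt (W k) o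
    vertex-block k o o≤ with m≤n⇒m<n∨m≡n o≤
    ... | inj₁ o<    = cong point (locate-within k o o<)
    ... | inj₂ refl  = trans (vertex-start (suc k)) (sym (vertexAt-end (W k)))

    edge-block : ∀ k o (lt : o < size k) → ς (edge (start k + o)) ≡ ς (arcAt (W k) o lt)
    edge-block k o lt = colour-endpoints _ _ (vertex-block k o (<⇒≤ lt))
      (trans (cong vertex (sym (+-suc (start k) o))) (vertex-block k (suc o) lt))

    start-step : ∀ k → start k < start (suc k)
    start-step k = m<m+n (start k) (len-pos (W k))

    start-mono : ∀ {a b} → a < b → start a < start b
    start-mono {a} {suc b} (s≤s a≤b) with m≤n⇒m<n∨m≡n a≤b
    ... | inj₁ a<b  = <-trans (start-mono a<b) (start-step b)
    ... | inj₂ refl = start-step a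

    turnsInside : ∀ k o → suc o < size k → Turns (suc (start k + o))
    turnsInside k o lt =
      subst₂ F (sym (edge-block k o lt₀))
               (sym (trans (cong (λ q → ς (edge q)) (sym (+-suc (start k) o))) (edge-block k (suc o) lt)))
               (hwalk-turns (W k) (Segment.hwalk (S k)) o lt₀ lt)
      where
      lt₀ : o < size k
      lt₀ = <-trans (n<1+n o) lt

    startOrTurns : ∀ r → (∃ λ k → start k ≡ r) ⊎ Turns r
    startOrTurns r with locate r | locate-position r | locate-valid r
    ... | k , zero  | at-r | _  = inj₁ (k , trans (sym (+-identityʳ (start k))) at-r)
    ... | k , suc o | at-r | lt = inj₂ (subst Turns (trans (sym (+-suc (start k) o)) at-r) (turnsInside k o lt))

    leaves : ∀ k r → start k < r → r ≤ start (suc k) → vertex r ≢ vertex (start k)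
    leaves k r start<r r≤end same = Segment.leaves (S k) o (m<n⇒0<n∸m start<r) o≤size (begin
      vertexAt (W k) o     ≡⟨ sym (vertex-block k o o≤size) ⟩
      vertex (start k + o) ≡⟨ cong vertex at-r ⟩
      vertex r             ≡⟨ same ⟩
      vertex (start k)     ≡⟨ vertex-start k ⟩
      x k                  ∎)
      where
      o = r ∸ start k
      at-r : start k + o ≡ r
      at-r = m+[n∸m]≡n (<⇒≤ start<r)
      o≤size : o ≤ size k
      o≤size = +-cancelˡ-≤ (start k) o (size k) (subst (_≤ start (suc k)) (sym at-r) r≤end)

    arrives : ∀ k r → start k ≤ r → r < start (suc k) → vertex r ≢ vertex (start (suc k))
    arrives k r start≤r r<end same = Segment.arrives (S k) o o<size (begin
      vertexAt (W k) o       ≡⟨ sym (vertex-block k o (<⇒≤ o<size)) ⟩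
      vertex (start k + o)   ≡⟨ cong vertex at-r ⟩
      vertex r               ≡⟨ same ⟩
      vertex (start (suc k)) ≡⟨ vertex-start (suc k) ⟩
      x (suc k)              ∎)
      where
      o = r ∸ start k
      at-r : start k + o ≡ r
      at-r = m+[n∸m]≡n start≤r
      o<size : o < size k
      o<size = +-cancelˡ-< (start k) o (size k) (subst (_< start (suc k)) (sym at-r) r<end)

-- Two of the first m + 2 blocks start at the
-- same cycle vertex, which gives a candidate for the descent; the resulting
-- shortcut is an H-walk from v_{i+1} back to v_i for some i.
mainTheorem1 : (n : ℕ) (D : Digraph n) → Loopless D →
    (U : Set) (F : U → U → Set) (ς : ∀ {u v} → Arc D u v → U) →
    ((C : Cycle (Arc D)) → IsHCycle D F ς C) →
    (C : Cycle (ClosureArc D F ς)) → HasSymmetricArc D F ς C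
mainTheorem1 n D _ U F ς allHCycles C = symmetricArc (fromRepeat repeated)
  where
  index : ℕ → Fin (suc (m C))
  index zero    = zero
  index (suc k) = next (index k)

  segment : ∀ k → Segment D F ς (vert C (index k)) (vert C (index (suc k)))
  segment k with arc C (index k)
  ... | distinct , w , hwalk = trim D F ς distinct w hwalk

  open Flatten D F ς (λ k → vert C (index k)) segment
  open Descent _≟_ vertex Turns start refl start-step startOrTurns leaves arrives
               (onceVisited D F ς allHCycles {vertex} {edge})

  Repeat : Set
  Repeat = ∃₂ λ (i j : Fin (suc (suc (m C)))) → i Fin.< j × index (toℕ i) ≡ index (toℕ j)

  repeated : Repeat
  repeated = pigeonhole (n<1+n (suc (m C))) (λ j → index (toℕ j))

  -- (taking the repetition as an argument keeps the pigeonhole witness from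
  -- being unfolded during type checking)
  fromRepeat : Repeat → Shortcut
  fromRepeat (i , j , i<j , same) = shortcut {start (toℕ i)} {start (toℕ j)} record
    { lo<hi    = start-mono {toℕ i} {toℕ j} i<j
    ; closed   = trans (vertex-start (toℕ i))
                       (trans (cong (vert C) same) (sym (vertex-start (toℕ j))))
    ; anchored = inj₁ (toℕ i , refl) }

  symmetricArc : Shortcut → HasSymmetricArc D F ς C
  symmetricArc shortcut′ =
    index k , (λ same → proj₁ (arc C (index k)) (sym same)) ,
    subst₂ (λ u v → Σ (Walk D u v) (IsHWalk D F ς))
           (trans from-end (vertex-start (suc k))) (trans to-start (vertex-start k))
           (Σ.map₂ proj₁ (stretchWalk (≤⇒≤‴ s<s') good))
    where open Shortcut shortcut′
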